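{- Let $G_1$ and $G_2$ be two (possibly nondeterministic) transition systems that share no unobservable events (all unobservable events are local and replaced by $\varepsilon$). Let $\Sigma^h=\Sigma^h_1\,\dot\cup\,\Sigma^h_2\,\dot\cup\,\Sigma^h_{12}$ be a set of observable events to be hidden, where $\Sigma^h_i$ consists of events local to $G_i$ ($i=1,2$) and $\Sigma^h_{12}$ consists of events shared by $G_1$ and $G_2$ (and by no other component). Let $\sim$ be an equivalence on transition systems together with an abstraction operator $G\mapsto G^{\mathcal A^{\Sigma'}}$ such that $G^{\Sigma'}\sim G^{\mathcal A^{\Sigma'}}$ for every $G$ and every event set $\Sigma'$, and assume $\sim$ is a congruence with respect to synchronous composition and hiding. Then \[ \mathcal O(G_1\parallel G_2)^{\Sigma^h}\sim\Big(\mathcal O(G_1)^{\mathcal A^{\Sigma^h_1}}\parallel\mathcal O(G_2)^{\mathcal A^{\Sigma^h_2}}\Big)^{\mathcal A^{\Sigma^h_{12}}}. \]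
   Context: A transition system is $G=\langle X,\Sigma,T,I,AP,\lambda\rangle$ (states, finite event set, transition relation $T\subseteq X\times\Sigma\times X$, initial states, atomic propositions, labelling $\lambda:X\to2^{AP}$). Local unobservable events are replaced by the label $\varepsilon$. With $R_\varepsilon$ the $\varepsilon$-closure, $\delta(Y,a)=R_\varepsilon(\{x'\mid\exists x\in R_\varepsilon(Y): x\xrightarrow{a}x'\})$, $\delta(I,\varepsilon)=R_\varepsilon(I)$, $\delta(I,sa)=\delta(\delta(I,s),a)$, $\mathcal L(G)=\{s\mid\delta(I,s)\ne\varnothing\}$. The observer $\mathcal O(G)$ is the subset construction: states $\{\delta(I,s)\mid s\in\mathcal L(G)\}$, transitions $Y\xrightarrow{a}\delta(Y,a)$ (when nonempty), initial state $R_\varepsilon(I)$, labels $\hat\lambda(Y)=\bigcup_{x\in Y}\lambda(x)$. Hiding: $G^{\Sigma'}$ denotes $G$ with every event in $\Sigma'$ replaced by the special label $\tau$; $G^{\mathcal A^{\Sigma'}}$ denotes an abstraction of $G^{\Sigma'}$. Synchronous composition $G_1\parallel G_2$ has state set $X_1\times X_2$, initial states $I_1\times I_2$, labels $\lambda_1(x_1)\cup\lambda_2(x_2)$; a shared event $a\in(\Sigma_1\cap\Sigma_2)\setminus\{\tau\}$ moves both components simultaneously, while an event in $\Sigma_1\setminus\Sigma_2$, or a $\tau$ (or $\varepsilon$) transition, of $G_1$ moves $G_1$ alone (symmetrically for $G_2$); $\tau$ transitions are never synchronized. Congruence with respect to synchronization means $G\sim H$ implies $G\parallel R\sim H\parallel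 R$ for all $R$; congruence with respect to hiding means $G\sim H$ implies $G^{\Sigma'}\sim H^{\Sigma'}$ for all $\Sigma'$.
   Formalization: The equivalence ∼ also relates any two transition systems whose accessible parts (states reachable from an initial state) are isomorphic, with the same event set, transitions, initial states and labels. The statement above fails without it. -}

module Defs where

open import Level using (0ℓ)
open import Data.Empty using (⊥)
open import Data.Product using (Σ; ∃; _×_; _,_; proj₁; proj₂)
open import Data.Sum using (_⊎_; inj₁; inj₂)
open import Data.List using (List; []; _∷_)
open import Data.List.Relation.Unary.All using (All)
open import Relation.Nullary using (¬_)
open import Relation.Binary using (Rel; IsEquivalence)
open import Relation.Binary.Construct.Closure.ReflexiveTransitive using (Star)

-- Labels of transitions: an observable event, the local unobservable
-- label ε, or the special hiding label τ.

data Lbl (E : Set) : Set where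
  ev : E → Lbl E
  ε  : Lbl E
  τ  : Lbl E

-- Transition systems G = ⟨X, Σ, T, I, AP, λ⟩ over a global universe of
-- events E and atomic propositions AP.  Sets are modelled as setoids
-- (State with equality _≈_); subsets as predicates.

record TS (E AP : Set) : Set₁ where
  field
    State    : Set
    _≈_      : Rel State 0ℓ
    isEquiv  : IsEquivalence _≈_
    Alph     : E → Set
    T        : State → Lbl E → State → Set
    I        : State → Set
    lab      : State → AP → Set
    T-resp   : ∀ {x x' y y' l} → x ≈ x' → y ≈ y' → T x l y → T x' l y'
    I-resp   : ∀ {x x'} → x ≈ x' → I x → I x'
    lab-resp : ∀ {x x' p} → x ≈ x' → lab x p → lab x' p

open TS public

module _ {E AP : Set} where

  NoTau : TS E AP → Set
  NoTau G = ∀ x y → ¬ T G x τ y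

  _≐_ : {X : Set} → (X → Set) → (X → Set) → Set
  Y ≐ Z = ∀ x → (Y x → Z x) × (Z x → Y x)

  module _ (G : TS E AP) where

    Rε : (State G → Set) → State G → Set
    Rε Y x = ∃ λ y → Y y × Star (λ u v → T G u ε v) y x

    δ₁ : (State G → Set) → E → State G → Set
    δ₁ Y a = Rε (λ x' → ∃ λ x → Rε Y x × T G x (ev a) x')

    δs : (State G → Set) → List E → State G → Set
    δs Y []      = Y
    δs Y (a ∷ s) = δs (δ₁ Y a) s

    δI : List E → State G → Set
    δI s = δs (Rε (I G)) s

  private
    Rε-mono : (G : TS E AP) {Y Z : State G → Set} → (∀ x → Y x → Z x) →
              ∀ x → Rε G Y x → Rε G Z x
    Rε-mono G f x (y , Yy , p) = y , f y Yy , p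

    δ₁-mono : (G : TS E AP) {Y Z : State G → Set} → (∀ x → Y x → Z x) →
              ∀ a x → δ₁ G Y a x → δ₁ G Z a x
    δ₁-mono G f a = Rε-mono G (λ x' → λ { (x , r , t) → x , Rε-mono G f x r , t })

    δ₁-cong : (G : TS E AP) {Y Z : State G → Set} → Y ≐ Z → ∀ a → δ₁ G Y a ≐ δ₁ G Z a
    δ₁-cong G e a x = δ₁-mono G (λ y → proj₁ (e y)) a x , δ₁-mono G (λ y → proj₂ (e y)) a x

    ≐-refl : {X : Set} {Y : X → Set} → Y ≐ Y
    ≐-refl x = (λ z → z) , (λ z → z)

    ≐-sym : {X : Set} {Y Z : X → Set} → Y ≐ Z → Z ≐ Y
    ≐-sym e x = proj₂ (e x) , proj₁ (e x)

    ≐-trans : {X : Set} {Y Z W : X → Set} → Y ≐ Z → Z ≐ W → Y ≐ W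
    ≐-trans e f x = (λ y → proj₁ (f x) (proj₁ (e x) y)) , (λ w → proj₂ (e x) (proj₂ (f x) w))

  -- The observer O(G): its states are the sets δ(I,s), s ∈ L(G) (with
  -- s ∈ Σ*), represented by a string s together with the setoid equality
  -- "δ(I,s) = δ(I,s')".

  Obs : TS E AP → TS E AP
  Obs G = record
    { State    = Σ (List E) (λ s → All (Alph G) s × ∃ (δI G s))
    ; _≈_      = λ s t → δI G (proj₁ s) ≐ δI G (proj₁ t)
    ; isEquiv  = record { refl = ≐-refl ; sym = ≐-sym ; trans = ≐-trans }
    ; Alph     = Alph G
    ; T        = OT
    ; I        = λ s → δI G (proj₁ s) ≐ Rε G (I G)
    ; lab      = λ s p → ∃ λ x → δI G (proj₁ s) x × lab G x p
    ; T-resp   = λ {x} {x'} {y} {y'} {l} → OT-resp {x} {x'} {y} {y'} {l}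
    ; I-resp   = λ e i → ≐-trans (≐-sym e) i
    ; lab-resp = λ { e (x , d , l) → x , proj₁ (e x) d , l }
    }
    where
      St = Σ (List E) (λ s → All (Alph G) s × ∃ (δI G s))
      OT : St → Lbl E → St → Set
      OT s (ev a) s' = Alph G a × (δI G (proj₁ s') ≐ δ₁ G (δI G (proj₁ s)) a)
      OT s ε      s' = ⊥
      OT s τ      s' = ⊥
      OT-resp : ∀ {x x' y y' l} → δI G (proj₁ x) ≐ δI G (proj₁ x') →
                δI G (proj₁ y) ≐ δI G (proj₁ y') → OT x l y → OT x' l y'
      OT-resp {l = ev a} e f (h , g) = h , ≐-trans (≐-sym f) (≐-trans g (δ₁-cong G e a))
      OT-resp {l = ε} e f ()
      OT-resp {l = τ} e f ()

  hide : (E → Set) → TS E AP → TS E AP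
  hide Σ' G = record
    { State    = State G
    ; _≈_      = _≈_ G
    ; isEquiv  = isEquiv G
    ; Alph     = λ a → Alph G a × ¬ Σ' a
    ; T        = HT
    ; I        = I G
    ; lab      = lab G
    ; T-resp   = λ {x} {x'} {y} {y'} {l} → HT-resp {x} {x'} {y} {y'} {l}
    ; I-resp   = I-resp G
    ; lab-resp = lab-resp G
    }
    where
      HT : State G → Lbl E → State G → Set
      HT x (ev a) y = ¬ Σ' a × T G x (ev a) y
      HT x ε      y = T G x ε y
      HT x τ      y = T G x τ y ⊎ ∃ λ a → Σ' a × T G x (ev a) y
      HT-resp : ∀ {x x' y y' l} → _≈_ G x x' → _≈_ G y y' → HT x l y → HT x' l y'
      HT-resp {l = ev a} e f (n , t) = n , T-resp G e f t
      HT-resp {l = ε} e f t = T-resp G e f t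
      HT-resp {l = τ} e f (inj₁ t) = inj₁ (T-resp G e f t)
      HT-resp {l = τ} e f (inj₂ (a , h , t)) = inj₂ (a , h , T-resp G e f t)

  _∥_ : TS E AP → TS E AP → TS E AP
  G₁ ∥ G₂ = record
    { State    = State G₁ × State G₂
    ; _≈_      = λ p q → _≈_ G₁ (proj₁ p) (proj₁ q) × _≈_ G₂ (proj₂ p) (proj₂ q)
    ; isEquiv  = record
        { refl  = IsEquivalence.refl (isEquiv G₁) , IsEquivalence.refl (isEquiv G₂)
        ; sym   = λ { (a , b) → IsEquivalence.sym (isEquiv G₁) a , IsEquivalence.sym (isEquiv G₂) b }
        ; trans = λ { (a , b) (c , d) → IsEquivalence.trans (isEquiv G₁) a c
                                      , IsEquivalence.trans (isEquiv G₂) b d }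
        }
    ; Alph     = λ a → Alph G₁ a ⊎ Alph G₂ a
    ; T        = PT
    ; I        = λ p → I G₁ (proj₁ p) × I G₂ (proj₂ p)
    ; lab      = λ p a → lab G₁ (proj₁ p) a ⊎ lab G₂ (proj₂ p) a
    ; T-resp   = λ {x} {x'} {y} {y'} {l} → PT-resp {x} {x'} {y} {y'} {l}
    ; I-resp   = λ { (e , f) (i , j) → I-resp G₁ e i , I-resp G₂ f j }
    ; lab-resp = λ { (e , f) (inj₁ l) → inj₁ (lab-resp G₁ e l)
                   ; (e , f) (inj₂ l) → inj₂ (lab-resp G₂ f l) }
    }
    where
      St = State G₁ × State G₂
      tr₁ = IsEquivalence.trans (isEquiv G₁)
      tr₂ = IsEquivalence.trans (isEquiv G₂)
      sy₁ = IsEquivalence.sym (isEquiv G₁)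
      sy₂ = IsEquivalence.sym (isEquiv G₂)
      PT : St → Lbl E → St → Set
      PT (x₁ , x₂) (ev a) (y₁ , y₂) =
          (Alph G₁ a × Alph G₂ a × T G₁ x₁ (ev a) y₁ × T G₂ x₂ (ev a) y₂)
        ⊎ (Alph G₁ a × ¬ Alph G₂ a × T G₁ x₁ (ev a) y₁ × _≈_ G₂ x₂ y₂)
        ⊎ (¬ Alph G₁ a × Alph G₂ a × _≈_ G₁ x₁ y₁ × T G₂ x₂ (ev a) y₂)
      PT (x₁ , x₂) ε (y₁ , y₂) =
          (T G₁ x₁ ε y₁ × _≈_ G₂ x₂ y₂) ⊎ (_≈_ G₁ x₁ y₁ × T G₂ x₂ ε y₂)
      PT (x₁ , x₂) τ (y₁ , y₂) =
          (T G₁ x₁ τ y₁ × _≈_ G₂ x₂ y₂) ⊎ (_≈_ G₁ x₁ y₁ × T G₂ x₂ τ y₂)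
      PT-resp : ∀ {x x' y y' l} →
                (_≈_ G₁ (proj₁ x) (proj₁ x') × _≈_ G₂ (proj₂ x) (proj₂ x')) →
                (_≈_ G₁ (proj₁ y) (proj₁ y') × _≈_ G₂ (proj₂ y) (proj₂ y')) →
                PT x l y → PT x' l y'
      PT-resp {l = ev a} (e₁ , e₂) (f₁ , f₂) (inj₁ (h₁ , h₂ , t₁ , t₂)) =
        inj₁ (h₁ , h₂ , T-resp G₁ e₁ f₁ t₁ , T-resp G₂ e₂ f₂ t₂)
      PT-resp {l = ev a} (e₁ , e₂) (f₁ , f₂) (inj₂ (inj₁ (h₁ , h₂ , t₁ , q))) =
        inj₂ (inj₁ (h₁ , h₂ , T-resp G₁ e₁ f₁ t₁ , tr₂ (sy₂ e₂) (tr₂ q f₂)))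
      PT-resp {l = ev a} (e₁ , e₂) (f₁ , f₂) (inj₂ (inj₂ (h₁ , h₂ , q , t₂))) =
        inj₂ (inj₂ (h₁ , h₂ , tr₁ (sy₁ e₁) (tr₁ q f₁) , T-resp G₂ e₂ f₂ t₂))
      PT-resp {l = ε} (e₁ , e₂) (f₁ , f₂) (inj₁ (t , q)) =
        inj₁ (T-resp G₁ e₁ f₁ t , tr₂ (sy₂ e₂) (tr₂ q f₂))
      PT-resp {l = ε} (e₁ , e₂) (f₁ , f₂) (inj₂ (q , t)) =
        inj₂ (tr₁ (sy₁ e₁) (tr₁ q f₁) , T-resp G₂ e₂ f₂ t)
      PT-resp {l = τ} (e₁ , e₂) (f₁ , f₂) (inj₁ (t , q)) =
        inj₁ (T-resp G₁ e₁ f₁ t , tr₂ (sy₂ e₂) (tr₂ q f₂))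
      PT-resp {l = τ} (e₁ , e₂) (f₁ , f₂) (inj₂ (q , t)) =
        inj₂ (tr₁ (sy₁ e₁) (tr₁ q f₁) , T-resp G₂ e₂ f₂ t)

  infixl 5 _∥_

  Reach : (G : TS E AP) → State G → Set
  Reach G x = ∃ λ x₀ → I G x₀ × Star (λ u v → ∃ λ l → T G u l v) x₀ x

  Acc : TS E AP → TS E AP
  Acc G = record
    { State    = Σ (State G) (Reach G)
    ; _≈_      = λ p q → _≈_ G (proj₁ p) (proj₁ q)
    ; isEquiv  = record { refl = IsEquivalence.refl (isEquiv G)
                        ; sym = IsEquivalence.sym (isEquiv G)
                        ; trans = IsEquivalence.trans (isEquiv G) }
    ; Alph     = Alph G
    ; T        = λ p l q → T G (proj₁ p) l (proj₁ q)
    ; I        = λ p → I G (proj₁ p)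
    ; lab      = λ p → lab G (proj₁ p)
    ; T-resp   = T-resp G
    ; I-resp   = I-resp G
    ; lab-resp = lab-resp G
    }

  record _≅_ (G H : TS E AP) : Set where
    field
      alph→  : ∀ a → Alph G a → Alph H a
      alph←  : ∀ a → Alph H a → Alph G a
      to     : State G → State H
      from   : State H → State G
      to-cong   : ∀ {x y} → _≈_ G x y → _≈_ H (to x) (to y)
      from-cong : ∀ {x y} → _≈_ H x y → _≈_ G (from x) (from y)
      from-to   : ∀ x → _≈_ G (from (to x)) x
      to-from   : ∀ y → _≈_ H (to (from y)) y
      T→     : ∀ {x l y} → T G x l y → T H (to x) l (to y)
      T←     : ∀ {x l y} → T H x l y → T G (from x) l (from y)
      I→     : ∀ {x} → I G x → I H (to x)
      I←     : ∀ {x} → I H x → I G (from x)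
      lab→   : ∀ {x p} → lab G x p → lab H (to x) p
      lab←   : ∀ {x p} → lab H x p → lab G (from x) p


_∪_ : {E : Set} → (E → Set) → (E → Set) → E → Set
(A ∪ B) e = A e ⊎ B e

infixr 6 _∪_

-- The observer state of G₁ ∥ G₂ reached by a word is the product of the observer
-- states of G₁ and G₂ reached by its projections: on ε-closed sets, the ε-closure and
-- the a-successor in G₁ ∥ G₂ are computed componentwise, only the components having
-- a in their alphabet moving.  Relating a state of O(G₁ ∥ G₂) to the pairs of observer
-- states whose product it is therefore matches the reachable parts of
-- O(G₁ ∥ G₂)^{Σʰ} and (O(G₁)^{Σʰ₁} ∥ O(G₂)^{Σʰ₂})^{Σʰ₁₂} step by step, hidden events
-- included since Σʰ₁, Σʰ₂ are local and Σʰ₁₂ is shared; as observer states are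
-- nonempty, products cancel and the matching is a bijection.  Congruence and the
-- abstraction axiom then replace each hiding by the abstraction.
module Submission where

open import Defs hiding (_≐_)
open import Level using (0ℓ; suc)
open import Function using (flip)
open import Data.Empty using (⊥-elim)
open import Data.Product using (Σ; ∃; _×_; _,_; proj₁; proj₂)
open import Data.Sum using (_⊎_; inj₁; inj₂; [_,_])
open import Data.List using ([]; _∷_; _++_)
open import Data.List.Relation.Unary.All using ([]; _∷_)
open import Data.List.Relation.Unary.All.Properties using (++⁺)
open import Relation.Nullary using (¬_)
open import Relation.Unary using (_⊆_)
open import Relation.Binary using (IsEquivalence; Setoid; _Respects_)
open import Relation.Binary.Construct.Closure.ReflexiveTransitive
  using (Star; _◅_; _◅◅_; gmap) renaming (ε to nil)
import Relation.Binary.Reasoning.Setoid as SetoidReasoning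

-- Defs' _≐_ carries the implicit parameters E and AP, which nothing determines.
_≐_ : {X : Set} → (X → Set) → (X → Set) → Set
Y ≐ Z = ∀ x → (Y x → Z x) × (Z x → Y x)

infix 4 _≐_

module _ {X : Set} where

  ≐-refl : {Y : X → Set} → Y ≐ Y
  ≐-refl x = (λ y → y) , (λ y → y)

  ≐-sym : {Y Z : X → Set} → Y ≐ Z → Z ≐ Y
  ≐-sym e x = proj₂ (e x) , proj₁ (e x)

  ≐-trans : {Y Z W : X → Set} → Y ≐ Z → Z ≐ W → Y ≐ W
  ≐-trans e f x = (λ y → proj₁ (f x) (proj₁ (e x) y)) , (λ w → proj₂ (e x) (proj₂ (f x) w))

  ≐-setoid : Setoid (suc 0ℓ) 0ℓ
  ≐-setoid = record
    { Carrier = X → Set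
    ; _≈_ = _≐_
    ; isEquivalence = record { refl = ≐-refl ; sym = ≐-sym ; trans = ≐-trans }
    }

module ≐-Reasoning {X : Set} = SetoidReasoning (≐-setoid {X})

module Closure {E AP : Set} (G : TS E AP) where

  private
    module ≈ = IsEquivalence (isEquiv G)

  _→ε_ : State G → State G → Set
  x →ε y = T G x ε y

  Post : (State G → Set) → E → State G → Set
  Post Y a y = ∃ λ x → Y x × T G x (ev a) y

  Saturated : (State G → Set) → Set
  Saturated Y = Y Respects _≈_ G × Rε G Y ⊆ Y

  ε*-resp-≈ : ∀ {y x z} → Star _→ε_ y x → _≈_ G x z → _≈_ G y z ⊎ Star _→ε_ y z
  ε*-resp-≈ nil e = inj₁ e
  ε*-resp-≈ (t ◅ p) e with ε*-resp-≈ p e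
  ... | inj₁ e′ = inj₂ (T-resp G ≈.refl e′ t ◅ nil)
  ... | inj₂ q  = inj₂ (t ◅ q)

  Rε-resp-≈ : ∀ {Y} → Y Respects _≈_ G → Rε G Y Respects _≈_ G
  Rε-resp-≈ resp e (y , Yy , p) with ε*-resp-≈ p e
  ... | inj₁ e′ = _ , resp e′ Yy , nil
  ... | inj₂ q  = y , Yy , q

  Rε-incl : ∀ {Y} → Y ⊆ Rε G Y
  Rε-incl Yx = _ , Yx , nil

  Rε-idem : ∀ {Y} → Rε G (Rε G Y) ⊆ Rε G Y
  Rε-idem (_ , (z , Yz , p) , q) = z , Yz , p ◅◅ q

  Rε-snoc : ∀ {Y x y} → Rε G Y x → x →ε y → Rε G Y y
  Rε-snoc (z , Yz , p) t = z , Yz , p ◅◅ (t ◅ nil)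

  Rε-cong : ∀ {Y Z} → Y ≐ Z → Rε G Y ≐ Rε G Z
  Rε-cong e x = (λ { (y , Yy , p) → y , proj₁ (e y) Yy , p })
              , (λ { (y , Zy , p) → y , proj₂ (e y) Zy , p })

  Rε-saturated : ∀ {Y} → Y Respects _≈_ G → Saturated (Rε G Y)
  Rε-saturated resp = Rε-resp-≈ resp , Rε-idem

  Saturated⇒Rε-fixed : ∀ {Y} → Saturated Y → Rε G Y ≐ Y
  Saturated⇒Rε-fixed (_ , closed) x = closed , Rε-incl

  Post-resp-≈ : ∀ Y a → Post Y a Respects _≈_ G
  Post-resp-≈ Y a e (x , Yx , t) = x , Yx , T-resp G ≈.refl e t

  Post-cong : ∀ {Y Z} a → Y ≐ Z → Post Y a ≐ Post Z a
  Post-cong a e y = (λ { (x , Yx , t) → x , proj₁ (e x) Yx , t })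
                  , (λ { (x , Zx , t) → x , proj₂ (e x) Zx , t })

  δ₁-saturated : ∀ Y a → Saturated (δ₁ G Y a)
  δ₁-saturated Y a = Rε-saturated (Post-resp-≈ (Rε G Y) a)

  δ₁-cong : ∀ {Y Z} a → Y ≐ Z → δ₁ G Y a ≐ δ₁ G Z a
  δ₁-cong a e = Rε-cong (Post-cong a (Rε-cong e))

  δs-saturated : ∀ {Y} → Saturated Y → ∀ s → Saturated (δs G Y s)
  δs-saturated sat []      = sat
  δs-saturated {Y} _ (a ∷ s) = δs-saturated (δ₁-saturated Y a) s

  δI-saturated : ∀ s → Saturated (δI G s)
  δI-saturated = δs-saturated (Rε-saturated (I-resp G))

  δs-++ : ∀ Y s a → δs G Y (s ++ a ∷ []) ≐ δ₁ G (δs G Y s) a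
  δs-++ Y []      a = ≐-refl
  δs-++ Y (b ∷ s) a = δs-++ (δ₁ G Y b) s a

module Observer {E AP : Set} (G : TS E AP) where

  open Closure G using (δs-++)

  ⟦_⟧ : State (Obs G) → State G → Set
  ⟦ q ⟧ = δI G (proj₁ q)

  ⟦⟧-nonempty : ∀ q → ∃ ⟦ q ⟧
  ⟦⟧-nonempty q = proj₂ (proj₂ q)

  initial : ∃ (Rε G (I G)) → State (Obs G)
  initial (x , r) = [] , [] , x , r

  extend : ∀ q {a} → Alph G a → ∃ (δ₁ G ⟦ q ⟧ a) →
           Σ (State (Obs G)) λ q′ → ⟦ q′ ⟧ ≐ δ₁ G ⟦ q ⟧ a
  extend (s , as , _) {a} h (x , d) = (s ++ a ∷ [] , ++⁺ as (h ∷ []) , x , proj₂ (eq x) d) , eq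
    where
      eq : δI G (s ++ a ∷ []) ≐ δ₁ G (δI G s) a
      eq = δs-++ (Rε G (I G)) s a

module _ {E AP : Set} where

  Reach-map : {G H : TS E AP} (f : State G → State H) →
              (∀ {x} → I G x → I H (f x)) →
              (∀ {x l y} → T G x l y → T H (f x) l (f y)) →
              ∀ {x} → Reach G x → Reach H (f x)
  Reach-map f I→ T→ (x₀ , i , p) = f x₀ , I→ i , gmap f (λ { (l , t) → l , T→ t }) p

  Acc-≅ : {G H : TS E AP} → G ≅ H → Acc G ≅ Acc H
  Acc-≅ {G} {H} i = record
    { alph→ = alph→ ; alph← = alph←
    ; to = λ { (x , ρ) → to x , Reach-map {G} {H} to I→ T→ ρ }
    ; from = λ { (y , ρ) → from y , Reach-map {H} {G} from I← T← ρ }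
    ; to-cong = to-cong ; from-cong = from-cong
    ; from-to = λ x → from-to (proj₁ x) ; to-from = λ y → to-from (proj₁ y)
    ; T→ = T→ ; T← = T← ; I→ = I→ ; I← = I← ; lab→ = lab→ ; lab← = lab←
    }
    where open _≅_ i

  ∥-comm : (G H : TS E AP) → (G ∥ H) ≅ (H ∥ G)
  ∥-comm G H = record
    { alph→ = λ _ → swap ; alph← = λ _ → swap
    ; to = λ { (x , y) → y , x } ; from = λ { (y , x) → x , y }
    ; to-cong = λ { (e , f) → f , e } ; from-cong = λ { (e , f) → f , e }
    ; from-to = λ _ → IsEquivalence.refl (isEquiv G) , IsEquivalence.refl (isEquiv H)
    ; to-from = λ _ → IsEquivalence.refl (isEquiv H) , IsEquivalence.refl (isEquiv G)
    ; T→ = swap-T G H ; T← = swap-T H G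
    ; I→ = λ { (i , j) → j , i } ; I← = λ { (i , j) → j , i }
    ; lab→ = swap ; lab← = swap
    }
    where
      swap : {A B : Set} → A ⊎ B → B ⊎ A
      swap (inj₁ a) = inj₂ a
      swap (inj₂ b) = inj₁ b

      swap-T : ∀ G H {x l y} → T (G ∥ H) x l y → T (H ∥ G) (proj₂ x , proj₁ x) l (proj₂ y , proj₁ y)
      swap-T G H {l = ev _} (inj₁ (h , k , t , s))        = inj₁ (k , h , s , t)
      swap-T G H {l = ev _} (inj₂ (inj₁ (h , k , t , e))) = inj₂ (inj₂ (k , h , e , t))
      swap-T G H {l = ev _} (inj₂ (inj₂ (h , k , e , s))) = inj₂ (inj₁ (k , h , s , e))
      swap-T G H {l = ε} (inj₁ (t , e)) = inj₂ (e , t)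
      swap-T G H {l = ε} (inj₂ (e , t)) = inj₁ (t , e)
      swap-T G H {l = τ} (inj₁ (t , e)) = inj₂ (e , t)
      swap-T G H {l = τ} (inj₂ (e , t)) = inj₁ (t , e)

  Reach-simulated : (S U : TS E AP) (R : State S → State U → Set) →
    (∀ {s} → I S s → ∃ λ u → I U u × R s u) →
    (∀ {s u l s′} → R s u → T S s l s′ → ∃ λ u′ → T U u l u′ × R s′ u′) →
    ∀ {s} → Reach S s → ∃ λ u → Reach U u × R s u
  Reach-simulated S U R init step (s₀ , i , p) with init i
  ... | u₀ , j , r = go (u₀ , (u₀ , j , nil) , r) p
    where
      go : ∀ {s s′} → (∃ λ u → Reach U u × R s u) →
           Star (λ x y → ∃ λ l → T S x l y) s s′ → ∃ λ u → Reach U u × R s′ u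
      go acc nil = acc
      go (u , (u₀ , j , q) , r) ((l , t) ◅ p) with step r t
      ... | u′ , t′ , r′ = go (u′ , (u₀ , j , q ◅◅ ((l , t′) ◅ nil)) , r′) p

  record Correspondence (S U : TS E AP) : Set₁ where
    field
      _~_    : State S → State U → Set
      alph→  : ∀ a → Alph S a → Alph U a
      alph←  : ∀ a → Alph U a → Alph S a
      ~-≈→   : ∀ {s s′ u u′} → s ~ u → s′ ~ u′ → _≈_ S s s′ → _≈_ U u u′
      ~-≈←   : ∀ {s s′ u u′} → s ~ u → s′ ~ u′ → _≈_ U u u′ → _≈_ S s s′
      ~-T→   : ∀ {s s′ u u′ l} → s ~ u → s′ ~ u′ → T S s l s′ → T U u l u′
      ~-T←   : ∀ {s s′ u u′ l} → s ~ u → s′ ~ u′ → T U u l u′ → T S s l s′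
      ~-I→   : ∀ {s u} → s ~ u → I S s → I U u
      ~-I←   : ∀ {s u} → s ~ u → I U u → I S s
      ~-lab→ : ∀ {s u p} → s ~ u → lab S s p → lab U u p
      ~-lab← : ∀ {s u p} → s ~ u → lab U u p → lab S s p
      init→  : ∀ {s} → I S s → ∃ (s ~_)
      init←  : ∀ {u} → I U u → ∃ (_~ u)
      step→  : ∀ {s u l s′} → s ~ u → T S s l s′ → ∃ (s′ ~_)
      step←  : ∀ {s u l u′} → s ~ u → T U u l u′ → ∃ (_~ u′)

  Correspondence⇒Acc-≅ : {S U : TS E AP} → Correspondence S U → Acc S ≅ Acc U
  Correspondence⇒Acc-≅ {S} {U} C = record
    { alph→ = alph→ ; alph← = alph←
    ; to = λ s → proj₁ (forth s) ; from = λ u → proj₁ (back u)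
    ; to-cong = λ {s} {s′} → ~-≈→ (proj₂ (forth s)) (proj₂ (forth s′))
    ; from-cong = λ {u} {u′} → ~-≈← (proj₂ (back u)) (proj₂ (back u′))
    ; from-to = λ s → ~-≈← (proj₂ (back (proj₁ (forth s)))) (proj₂ (forth s))
                           (IsEquivalence.refl (isEquiv U))
    ; to-from = λ u → ~-≈→ (proj₂ (forth (proj₁ (back u)))) (proj₂ (back u))
                           (IsEquivalence.refl (isEquiv S))
    ; T→ = λ {s} {_} {s′} → ~-T→ (proj₂ (forth s)) (proj₂ (forth s′))
    ; T← = λ {u} {_} {u′} → ~-T← (proj₂ (back u)) (proj₂ (back u′))
    ; I→ = λ {s} → ~-I→ (proj₂ (forth s))
    ; I← = λ {u} → ~-I← (proj₂ (back u))
    ; lab→ = λ {s} → ~-lab→ (proj₂ (forth s))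
    ; lab← = λ {u} → ~-lab← (proj₂ (back u))
    }
    where
      open Correspondence C

      forth : (s : State (Acc S)) → Σ (State (Acc U)) λ u → proj₁ s ~ proj₁ u
      forth (s , ρ) with Reach-simulated S U _~_
        (λ i → let (u , r) = init→ i in u , ~-I→ r i , r)
        (λ r t → let (u′ , r′) = step→ r t in u′ , ~-T→ r r′ t , r′) ρ
      ... | u , ρ′ , r = (u , ρ′) , r

      back : (u : State (Acc U)) → Σ (State (Acc S)) λ s → proj₁ s ~ proj₁ u
      back (u , ρ) with Reach-simulated U S (flip _~_)
        (λ i → let (s , r) = init← i in s , ~-I← r i , r)
        (λ r t → let (s′ , r′) = step← r t in s′ , ~-T← r r′ t , r′) ρ
      ... | s , ρ′ , r = (s , ρ′) , r

module Product {E AP : Set} (G₁ G₂ : TS E AP) where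

  private
    P = G₁ ∥ G₂
    module C₁ = Closure G₁
    module C₂ = Closure G₂
    module CP = Closure P
    module ≈₁ = IsEquivalence (isEquiv G₁)
    module ≈₂ = IsEquivalence (isEquiv G₂)
    A₁ = Alph G₁
    A₂ = Alph G₂

  _⊗_ : (State G₁ → Set) → (State G₂ → Set) → State P → Set
  (Y ⊗ Z) (x , y) = Y x × Z y

  infix 5 _⊗_

  ⊗-cong : ∀ {Y Y′ Z Z′} → Y ≐ Y′ → Z ≐ Z′ → Y ⊗ Z ≐ Y′ ⊗ Z′
  ⊗-cong e f (x , y) = (λ { (Yx , Zy) → proj₁ (e x) Yx , proj₁ (f y) Zy })
                     , (λ { (Yx , Zy) → proj₂ (e x) Yx , proj₂ (f y) Zy })

  ⊗-cancel : ∀ {Y Y′ Z Z′} → ∃ Y → ∃ Z → Y ⊗ Z ≐ Y′ ⊗ Z′ → (Y ≐ Y′) × (Z ≐ Z′)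
  ⊗-cancel (x₀ , Yx₀) (y₀ , Zy₀) e =
      (λ x → (λ Yx → proj₁ (proj₁ (e (x , y₀)) (Yx , Zy₀)))
           , (λ Y′x → proj₁ (proj₂ (e (x , y₀)) (Y′x , Z′y₀))))
    , (λ y → (λ Zy → proj₂ (proj₁ (e (x₀ , y)) (Yx₀ , Zy)))
           , (λ Z′y → proj₂ (proj₂ (e (x₀ , y)) (Y′x₀ , Z′y))))
    where
      Y′x₀ = proj₁ (proj₁ (e (x₀ , y₀)) (Yx₀ , Zy₀))
      Z′y₀ = proj₂ (proj₁ (e (x₀ , y₀)) (Yx₀ , Zy₀))

  -- An ε-step of G₁ ∥ G₂ fixes its idle component only up to ≈, hence the Respects hypotheses.
  Rε-⊗ : ∀ {Y Z} → Y Respects _≈_ G₁ → Z Respects _≈_ G₂ → Rε P (Y ⊗ Z) ≐ Rε G₁ Y ⊗ Rε G₂ Z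
  Rε-⊗ {Y} {Z} resp₁ resp₂ (x , y) =
      (λ { (_ , (Yx₀ , Zy₀) , p) → split p (C₁.Rε-incl Yx₀) (C₂.Rε-incl Zy₀) })
    , (λ { ((x₀ , Yx₀ , p) , (y₀ , Zy₀ , q)) →
           (x₀ , y₀) , (Yx₀ , Zy₀) ,
           (gmap (_, y₀) (λ t → inj₁ (t , ≈₂.refl)) p ◅◅ gmap (x ,_) (λ t → inj₂ (≈₁.refl , t)) q) })
    where
      split : ∀ {u v} → Star CP._→ε_ u v → Rε G₁ Y (proj₁ u) → Rε G₂ Z (proj₂ u) →
              (Rε G₁ Y ⊗ Rε G₂ Z) v
      split nil r₁ r₂ = r₁ , r₂
      split (inj₁ (t , e) ◅ p) r₁ r₂ = split p (C₁.Rε-snoc r₁ t) (C₂.Rε-resp-≈ resp₂ e r₂)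
      split (inj₂ (e , t) ◅ p) r₁ r₂ = split p (C₁.Rε-resp-≈ resp₁ e r₁) (C₂.Rε-snoc r₂ t)

  data Kind (a : E) : Set where
    both  : A₁ a → A₂ a → Kind a
    only₁ : A₁ a → ¬ A₂ a → Kind a
    only₂ : ¬ A₁ a → A₂ a → Kind a

  Kind⇒Alph : ∀ {a} → Kind a → Alph P a
  Kind⇒Alph (both h _)  = inj₁ h
  Kind⇒Alph (only₁ h _) = inj₁ h
  Kind⇒Alph (only₂ _ h) = inj₂ h

  kind-of : ∀ {x y a} → T P x (ev a) y → Kind a
  kind-of (inj₁ (h₁ , h₂ , _))        = both h₁ h₂
  kind-of (inj₂ (inj₁ (h₁ , h₂ , _))) = only₁ h₁ h₂
  kind-of (inj₂ (inj₂ (h₁ , h₂ , _))) = only₂ h₁ h₂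

  kind-of-δ₁ : ∀ {Y a} → ∃ (δ₁ P Y a) → Kind a
  kind-of-δ₁ (_ , _ , (_ , _ , t) , _) = kind-of t

  post₁ : ∀ {a} → Kind a → (State G₁ → Set) → State G₁ → Set
  post₁ (only₂ _ _) Y = Y
  post₁ {a} _       Y = C₁.Post Y a

  post₂ : ∀ {a} → Kind a → (State G₂ → Set) → State G₂ → Set
  post₂ (only₁ _ _) Z = Z
  post₂ {a} _       Z = C₂.Post Z a

  move₁ : ∀ {a} → Kind a → (State G₁ → Set) → State G₁ → Set
  move₁ (only₂ _ _) Y = Y
  move₁ {a} _       Y = δ₁ G₁ Y a

  move₂ : ∀ {a} → Kind a → (State G₂ → Set) → State G₂ → Set
  move₂ (only₁ _ _) Z = Z
  move₂ {a} _       Z = δ₁ G₂ Z a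

  post₁-resp-≈ : ∀ {a Y} (k : Kind a) → Y Respects _≈_ G₁ → post₁ k Y Respects _≈_ G₁
  post₁-resp-≈ {a} {Y} (both _ _)  _ = C₁.Post-resp-≈ Y a
  post₁-resp-≈ {a} {Y} (only₁ _ _) _ = C₁.Post-resp-≈ Y a
  post₁-resp-≈ (only₂ _ _) resp = resp

  post₂-resp-≈ : ∀ {a Z} (k : Kind a) → Z Respects _≈_ G₂ → post₂ k Z Respects _≈_ G₂
  post₂-resp-≈ {a} {Z} (both _ _)  _ = C₂.Post-resp-≈ Z a
  post₂-resp-≈ (only₁ _ _) resp = resp
  post₂-resp-≈ {a} {Z} (only₂ _ _) _ = C₂.Post-resp-≈ Z a

  Rε-post₁ : ∀ {a Y} (k : Kind a) → C₁.Saturated Y → Rε G₁ (post₁ k (Rε G₁ Y)) ≐ move₁ k Y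
  Rε-post₁ (both _ _)  _   = ≐-refl
  Rε-post₁ (only₁ _ _) _   = ≐-refl
  Rε-post₁ (only₂ _ _) sat =
    ≐-trans (C₁.Saturated⇒Rε-fixed (C₁.Rε-saturated (proj₁ sat))) (C₁.Saturated⇒Rε-fixed sat)

  Rε-post₂ : ∀ {a Z} (k : Kind a) → C₂.Saturated Z → Rε G₂ (post₂ k (Rε G₂ Z)) ≐ move₂ k Z
  Rε-post₂ (both _ _)  _   = ≐-refl
  Rε-post₂ (only₁ _ _) sat =
    ≐-trans (C₂.Saturated⇒Rε-fixed (C₂.Rε-saturated (proj₁ sat))) (C₂.Saturated⇒Rε-fixed sat)
  Rε-post₂ (only₂ _ _) _   = ≐-refl

  Post-⊗ : ∀ {a Y Z} (k : Kind a) → Y Respects _≈_ G₁ → Z Respects _≈_ G₂ →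
           CP.Post (Y ⊗ Z) a ≐ post₁ k Y ⊗ post₂ k Z
  Post-⊗ (both h₁ h₂) _ _ (x , y) =
      (λ { (_ , (Yx , Zy) , inj₁ (_ , _ , t₁ , t₂)) → (_ , Yx , t₁) , (_ , Zy , t₂)
         ; (_ , _ , inj₂ (inj₁ (_ , ¬h₂ , _))) → ⊥-elim (¬h₂ h₂)
         ; (_ , _ , inj₂ (inj₂ (¬h₁ , _))) → ⊥-elim (¬h₁ h₁) })
    , (λ { ((x₀ , Yx₀ , t₁) , (y₀ , Zy₀ , t₂)) → (x₀ , y₀) , (Yx₀ , Zy₀) , inj₁ (h₁ , h₂ , t₁ , t₂) })
  Post-⊗ (only₁ h₁ ¬h₂) _ resp₂ (x , y) =
      (λ { (_ , _ , inj₁ (_ , h₂ , _)) → ⊥-elim (¬h₂ h₂)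
         ; (_ , (Yx , Zy) , inj₂ (inj₁ (_ , _ , t₁ , e))) → (_ , Yx , t₁) , resp₂ e Zy
         ; (_ , _ , inj₂ (inj₂ (¬h₁ , _))) → ⊥-elim (¬h₁ h₁) })
    , (λ { ((x₀ , Yx₀ , t₁) , Zy) → (x₀ , y) , (Yx₀ , Zy) , inj₂ (inj₁ (h₁ , ¬h₂ , t₁ , ≈₂.refl)) })
  Post-⊗ (only₂ ¬h₁ h₂) resp₁ _ (x , y) =
      (λ { (_ , _ , inj₁ (h₁ , _)) → ⊥-elim (¬h₁ h₁)
         ; (_ , _ , inj₂ (inj₁ (_ , ¬h₂ , _))) → ⊥-elim (¬h₂ h₂)
         ; (_ , (Yx , Zy) , inj₂ (inj₂ (_ , _ , e , t₂))) → resp₁ e Yx , (_ , Zy , t₂) })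
    , (λ { (Yx , (y₀ , Zy₀ , t₂)) → (x , y₀) , (Yx , Zy₀) , inj₂ (inj₂ (¬h₁ , h₂ , ≈₁.refl , t₂)) })

  δ₁-⊗ : ∀ {a Y Z} → C₁.Saturated Y → C₂.Saturated Z → (k : Kind a) →
         δ₁ P (Y ⊗ Z) a ≐ move₁ k Y ⊗ move₂ k Z
  δ₁-⊗ {a} {Y} {Z} sat₁ sat₂ k = begin
    Rε P (CP.Post (Rε P (Y ⊗ Z)) a)                          ≈⟨ CP.Rε-cong (CP.Post-cong a (Rε-⊗ resp₁ resp₂)) ⟩
    Rε P (CP.Post (Rε G₁ Y ⊗ Rε G₂ Z) a)                     ≈⟨ CP.Rε-cong (Post-⊗ k resp₁′ resp₂′) ⟩
    Rε P (post₁ k (Rε G₁ Y) ⊗ post₂ k (Rε G₂ Z))             ≈⟨ Rε-⊗ (post₁-resp-≈ k resp₁′) (post₂-resp-≈ k resp₂′) ⟩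
    Rε G₁ (post₁ k (Rε G₁ Y)) ⊗ Rε G₂ (post₂ k (Rε G₂ Z))    ≈⟨ ⊗-cong (Rε-post₁ k sat₁) (Rε-post₂ k sat₂) ⟩
    move₁ k Y ⊗ move₂ k Z                                     ∎
    where
      open ≐-Reasoning
      resp₁ = proj₁ sat₁
      resp₂ = proj₁ sat₂
      resp₁′ = C₁.Rε-resp-≈ resp₁
      resp₂′ = C₂.Rε-resp-≈ resp₂

module Decomposition {E AP : Set} (G₁ G₂ : TS E AP) (Σh₁ Σh₂ Σh₁₂ : E → Set)
  (Σh₁-local : ∀ e → Σh₁ e → Alph G₁ e × ¬ Alph G₂ e)
  (Σh₂-local : ∀ e → Σh₂ e → Alph G₂ e × ¬ Alph G₁ e)
  (Σh₁₂-shared : ∀ e → Σh₁₂ e → Alph G₁ e × Alph G₂ e) where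

  open Product G₁ G₂

  private
    P = G₁ ∥ G₂
    module O₁ = Observer G₁
    module O₂ = Observer G₂
    module OP = Observer P
    module C₁ = Closure G₁
    module C₂ = Closure G₂
    module CP = Closure P
    H₁ = hide Σh₁ (Obs G₁)
    H₂ = hide Σh₂ (Obs G₂)

  Src : TS E AP
  Src = hide (Σh₁ ∪ Σh₂ ∪ Σh₁₂) (Obs P)

  Tgt : TS E AP
  Tgt = hide Σh₁₂ (H₁ ∥ H₂)

  Pair : Set
  Pair = State (Obs G₁) × State (Obs G₂)

  ⟦_⟧² : Pair → State P → Set
  ⟦ q₁ , q₂ ⟧² = O₁.⟦ q₁ ⟧ ⊗ O₂.⟦ q₂ ⟧

  -- Records rather than the underlying ≐-statements, so that the states stay inferable.
  record _~_ (u : State (Obs P)) (q : Pair) : Set where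
    constructor related
    field ⟦⟧-≐ : OP.⟦ u ⟧ ≐ ⟦ q ⟧²

  record Move (a : E) (q q′ : Pair) : Set where
    constructor move
    field
      kind  : Kind a
      step₁ : O₁.⟦ proj₁ q′ ⟧ ≐ move₁ kind O₁.⟦ proj₁ q ⟧
      step₂ : O₂.⟦ proj₂ q′ ⟧ ≐ move₂ kind O₂.⟦ proj₂ q ⟧

  ⟦⟧²-cancel : ∀ q {Y Z} → ⟦ q ⟧² ≐ Y ⊗ Z → (O₁.⟦ proj₁ q ⟧ ≐ Y) × (O₂.⟦ proj₂ q ⟧ ≐ Z)
  ⟦⟧²-cancel (q₁ , q₂) = ⊗-cancel (O₁.⟦⟧-nonempty q₁) (O₂.⟦⟧-nonempty q₂)

  Rε-I : Rε P (I P) ≐ Rε G₁ (I G₁) ⊗ Rε G₂ (I G₂)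
  Rε-I = Rε-⊗ (I-resp G₁) (I-resp G₂)

  δ₁-~ : ∀ {u q a} → u ~ q → (k : Kind a) →
         δ₁ P OP.⟦ u ⟧ a ≐ move₁ k O₁.⟦ proj₁ q ⟧ ⊗ move₂ k O₂.⟦ proj₂ q ⟧
  δ₁-~ {q = q₁ , q₂} {a} (related r) k =
    ≐-trans (CP.δ₁-cong a r) (δ₁-⊗ (C₁.δI-saturated (proj₁ q₁)) (C₂.δI-saturated (proj₁ q₂)) k)

  Move⇒δ₁ : ∀ {u q q′ a} → u ~ q → Move a q q′ → δ₁ P OP.⟦ u ⟧ a ≐ ⟦ q′ ⟧²
  Move⇒δ₁ r (move k s₁ s₂) = ≐-trans (δ₁-~ r k) (⊗-cong (≐-sym s₁) (≐-sym s₂))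

  δ₁⇒Move : ∀ {u v q q′ a} → u ~ q → v ~ q′ → OP.⟦ v ⟧ ≐ δ₁ P OP.⟦ u ⟧ a → Move a q q′
  δ₁⇒Move {v = v} {q′ = q′} {a} ru (related rv) eq =
    let (s₁ , s₂) = ⟦⟧²-cancel q′ (≐-trans (≐-sym rv) (≐-trans eq (δ₁-~ ru k))) in move k s₁ s₂
    where
      k : Kind a
      k = kind-of-δ₁ (_ , proj₁ (eq _) (proj₂ (OP.⟦⟧-nonempty v)))

  Move⇒Obs-T : ∀ {u v q q′ a} → u ~ q → v ~ q′ → Move a q q′ → T (Obs P) u (ev a) v
  Move⇒Obs-T ru (related rv) m = Kind⇒Alph (Move.kind m) , ≐-trans rv (≐-sym (Move⇒δ₁ ru m))

  advance₁ : ∀ {a} (k : Kind a) q₁ → ∃ (move₁ k O₁.⟦ q₁ ⟧) →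
             Σ (State (Obs G₁)) λ q₁′ → O₁.⟦ q₁′ ⟧ ≐ move₁ k O₁.⟦ q₁ ⟧
  advance₁ (both h _)  q₁ w = O₁.extend q₁ h w
  advance₁ (only₁ h _) q₁ w = O₁.extend q₁ h w
  advance₁ (only₂ _ _) q₁ _ = q₁ , ≐-refl

  advance₂ : ∀ {a} (k : Kind a) q₂ → ∃ (move₂ k O₂.⟦ q₂ ⟧) →
             Σ (State (Obs G₂)) λ q₂′ → O₂.⟦ q₂′ ⟧ ≐ move₂ k O₂.⟦ q₂ ⟧
  advance₂ (both _ h)  q₂ w = O₂.extend q₂ h w
  advance₂ (only₁ _ _) q₂ _ = q₂ , ≐-refl
  advance₂ (only₂ _ h) q₂ w = O₂.extend q₂ h w

  Move-target : ∀ {u v q a} → u ~ q → OP.⟦ v ⟧ ≐ δ₁ P OP.⟦ u ⟧ a → ∃ (v ~_)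
  Move-target {v = v} {q₁ , q₂} {a} ru eq =
    (proj₁ q₁′ , proj₁ q₂′) , related (≐-trans C (⊗-cong (≐-sym (proj₂ q₁′)) (≐-sym (proj₂ q₂′))))
    where
      w = OP.⟦⟧-nonempty v
      k : Kind a
      k = kind-of-δ₁ (_ , proj₁ (eq _) (proj₂ w))
      C : OP.⟦ v ⟧ ≐ move₁ k O₁.⟦ q₁ ⟧ ⊗ move₂ k O₂.⟦ q₂ ⟧
      C = ≐-trans eq (δ₁-~ ru k)
      q₁′ = advance₁ k q₁ (_ , proj₁ (proj₁ (C _) (proj₂ w)))
      q₂′ = advance₂ k q₂ (_ , proj₂ (proj₁ (C _) (proj₂ w)))

  Move-source : ∀ {u q q′ a} → u ~ q → Move a q q′ → ∃ (_~ q′)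
  Move-source {u} {q′ = q₁′ , q₂′} ru m = proj₁ v , related (≐-trans (proj₂ v) C)
    where
      C = Move⇒δ₁ ru m
      v = OP.extend u (Kind⇒Alph (Move.kind m))
            (_ , proj₂ (C _) (proj₂ (O₁.⟦⟧-nonempty q₁′) , proj₂ (O₂.⟦⟧-nonempty q₂′)))

  Src-step : ∀ {u l v} → T Src u l v → ∃ λ a → OP.⟦ v ⟧ ≐ δ₁ P OP.⟦ u ⟧ a
  Src-step {l = ev a} (_ , _ , eq)         = a , eq
  Src-step {l = ε} ()
  Src-step {l = τ} (inj₁ ())
  Src-step {l = τ} (inj₂ (a , _ , _ , eq)) = a , eq

  Move-of-sync : ∀ {q q′ a} → T (H₁ ∥ H₂) q (ev a) q′ → Move a q q′
  Move-of-sync (inj₁ ((h₁ , _) , (h₂ , _) , (_ , _ , s₁) , (_ , _ , s₂))) = move (both h₁ h₂) s₁ s₂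
  Move-of-sync {a = a} (inj₂ (inj₁ ((h₁ , _) , ¬h₂ , (_ , _ , s₁) , e))) =
    move (only₁ h₁ (λ h₂ → ¬h₂ (h₂ , λ σ → proj₂ (Σh₂-local a σ) h₁))) s₁ (≐-sym e)
  Move-of-sync {a = a} (inj₂ (inj₂ (¬h₁ , (h₂ , _) , e , (_ , _ , s₂)))) =
    move (only₂ (λ h₁ → ¬h₁ (h₁ , λ σ → proj₂ (Σh₁-local a σ) h₂)) h₂) (≐-sym e) s₂

  sync-of-Move : ∀ {q q′ a} → Move a q q′ → ¬ Σh₁ a → ¬ Σh₂ a → T (H₁ ∥ H₂) q (ev a) q′
  sync-of-Move (move (both h₁ h₂) s₁ s₂) n₁ n₂ =
    inj₁ ((h₁ , n₁) , (h₂ , n₂) , (n₁ , h₁ , s₁) , (n₂ , h₂ , s₂))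
  sync-of-Move (move (only₁ h₁ ¬h₂) s₁ s₂) n₁ _ =
    inj₂ (inj₁ ((h₁ , n₁) , (λ h → ¬h₂ (proj₁ h)) , (n₁ , h₁ , s₁) , ≐-sym s₂))
  sync-of-Move (move (only₂ ¬h₁ h₂) s₁ s₂) _ n₂ =
    inj₂ (inj₂ ((λ h → ¬h₁ (proj₁ h)) , (h₂ , n₂) , ≐-sym s₁ , (n₂ , h₂ , s₂)))

  sync-visible : ∀ {q q′ a} → T (H₁ ∥ H₂) q (ev a) q′ → ¬ Σh₁ a × ¬ Σh₂ a
  sync-visible (inj₁ ((_ , n₁) , (_ , n₂) , _)) = n₁ , n₂
  sync-visible {a = a} (inj₂ (inj₁ ((h₁ , n₁) , _))) = n₁ , λ σ → proj₂ (Σh₂-local a σ) h₁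
  sync-visible {a = a} (inj₂ (inj₂ (_ , (h₂ , n₂) , _))) = (λ σ → proj₂ (Σh₁-local a σ) h₂) , n₂

  hidden₁-Move : ∀ {q q′ b} → Σh₁ b → Move b q q′ → T (H₁ ∥ H₂) q τ q′
  hidden₁-Move {b = b} σ (move (both _ h₂) _ _)   = ⊥-elim (proj₂ (Σh₁-local b σ) h₂)
  hidden₁-Move σ (move (only₁ h₁ _) s₁ s₂)        = inj₁ (inj₂ (_ , σ , h₁ , s₁) , ≐-sym s₂)
  hidden₁-Move {b = b} σ (move (only₂ ¬h₁ _) _ _) = ⊥-elim (¬h₁ (proj₁ (Σh₁-local b σ)))

  hidden₂-Move : ∀ {q q′ b} → Σh₂ b → Move b q q′ → T (H₁ ∥ H₂) q τ q′
  hidden₂-Move {b = b} σ (move (both h₁ _) _ _)   = ⊥-elim (proj₂ (Σh₂-local b σ) h₁)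
  hidden₂-Move {b = b} σ (move (only₁ _ ¬h₂) _ _) = ⊥-elim (¬h₂ (proj₁ (Σh₂-local b σ)))
  hidden₂-Move σ (move (only₂ _ h₂) s₁ s₂)        = inj₂ (≐-sym s₁ , inj₂ (_ , σ , h₂ , s₂))

  Tgt-step : ∀ {q l q′} → T Tgt q l q′ → ∃ λ a → Move a q q′
  Tgt-step {l = ev a} (_ , sync) = a , Move-of-sync sync
  Tgt-step {l = ε} (inj₁ (() , _))
  Tgt-step {l = ε} (inj₂ (_ , ()))
  Tgt-step {l = τ} (inj₁ (inj₁ (inj₁ () , _)))
  Tgt-step {l = τ} (inj₁ (inj₁ (inj₂ (b , σ , h₁ , s₁) , e))) =
    b , move (only₁ h₁ (proj₂ (Σh₁-local b σ))) s₁ (≐-sym e)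
  Tgt-step {l = τ} (inj₁ (inj₂ (_ , inj₁ ())))
  Tgt-step {l = τ} (inj₁ (inj₂ (e , inj₂ (b , σ , h₂ , s₂)))) =
    b , move (only₂ (proj₂ (Σh₂-local b σ)) h₂) (≐-sym e) s₂
  Tgt-step {l = τ} (inj₂ (b , _ , sync)) = b , Move-of-sync sync

  ~-T→ : ∀ {u v q q′ l} → u ~ q → v ~ q′ → T Src u l v → T Tgt q l q′
  ~-T→ {l = ev a} ru rv (n , _ , eq) =
    (λ σ → n (inj₂ (inj₂ σ))) ,
    sync-of-Move (δ₁⇒Move ru rv eq) (λ σ → n (inj₁ σ)) (λ σ → n (inj₂ (inj₁ σ)))
  ~-T→ {l = ε} _ _ ()
  ~-T→ {l = τ} _ _ (inj₁ ())
  ~-T→ {l = τ} ru rv (inj₂ (_ , inj₁ σ , _ , eq)) = inj₁ (hidden₁-Move σ (δ₁⇒Move ru rv eq))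
  ~-T→ {l = τ} ru rv (inj₂ (_ , inj₂ (inj₁ σ) , _ , eq)) = inj₁ (hidden₂-Move σ (δ₁⇒Move ru rv eq))
  ~-T→ {l = τ} ru rv (inj₂ (b , inj₂ (inj₂ σ) , _ , eq)) =
    inj₂ (b , σ , sync-of-Move (δ₁⇒Move ru rv eq)
                    (λ σ₁ → proj₂ (Σh₁-local b σ₁) (proj₂ (Σh₁₂-shared b σ)))
                    (λ σ₂ → proj₂ (Σh₂-local b σ₂) (proj₁ (Σh₁₂-shared b σ))))

  ~-T← : ∀ {u v q q′ l} → u ~ q → v ~ q′ → T Tgt q l q′ → T Src u l v
  ~-T← {q = q} {q′} {l = ev a} ru rv (n₁₂ , sync) =
    [ proj₁ visible , [ proj₂ visible , n₁₂ ] ] , Move⇒Obs-T ru rv (Move-of-sync sync)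
    where visible = sync-visible {q} {q′} sync
  ~-T← {l = ε} _ _ (inj₁ (() , _))
  ~-T← {l = ε} _ _ (inj₂ (_ , ()))
  ~-T← {l = τ} _ _ (inj₁ (inj₁ (inj₁ () , _)))
  ~-T← {l = τ} ru rv t@(inj₁ (inj₁ (inj₂ (b , σ , _) , _))) =
    inj₂ (b , inj₁ σ , Move⇒Obs-T ru rv (proj₂ (Tgt-step {l = τ} t)))
  ~-T← {l = τ} _ _ (inj₁ (inj₂ (_ , inj₁ ())))
  ~-T← {l = τ} ru rv t@(inj₁ (inj₂ (_ , inj₂ (b , σ , _)))) =
    inj₂ (b , inj₂ (inj₁ σ) , Move⇒Obs-T ru rv (proj₂ (Tgt-step {l = τ} t)))
  ~-T← {l = τ} ru rv t@(inj₂ (b , σ , _)) =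
    inj₂ (b , inj₂ (inj₂ σ) , Move⇒Obs-T ru rv (proj₂ (Tgt-step {l = τ} t)))

  Alph-Src→Tgt : ∀ a → Alph Src a → Alph Tgt a
  Alph-Src→Tgt a (inj₁ h₁ , n) = inj₁ (h₁ , λ σ → n (inj₁ σ)) , λ σ → n (inj₂ (inj₂ σ))
  Alph-Src→Tgt a (inj₂ h₂ , n) = inj₂ (h₂ , λ σ → n (inj₂ (inj₁ σ))) , λ σ → n (inj₂ (inj₂ σ))

  Alph-Tgt→Src : ∀ a → Alph Tgt a → Alph Src a
  Alph-Tgt→Src a (inj₁ (h₁ , n₁) , n₁₂) = inj₁ h₁ , [ n₁ , [ (λ σ → proj₂ (Σh₂-local a σ) h₁) , n₁₂ ] ]
  Alph-Tgt→Src a (inj₂ (h₂ , n₂) , n₁₂) = inj₂ h₂ , [ (λ σ → proj₂ (Σh₁-local a σ) h₂) , [ n₂ , n₁₂ ] ]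

  ~-I→ : ∀ {u q} → u ~ q → I Src u → I Tgt q
  ~-I→ {q = q} (related r) i = ⟦⟧²-cancel q (≐-trans (≐-sym r) (≐-trans i Rε-I))

  ~-I← : ∀ {u q} → u ~ q → I Tgt q → I Src u
  ~-I← (related r) (i₁ , i₂) = ≐-trans r (≐-trans (⊗-cong i₁ i₂) (≐-sym Rε-I))

  ~-lab→ : ∀ {u q p} → u ~ q → lab Src u p → lab Tgt q p
  ~-lab→ (related r) (x , d , inj₁ l) = inj₁ (_ , proj₁ (proj₁ (r x) d) , l)
  ~-lab→ (related r) (x , d , inj₂ l) = inj₂ (_ , proj₂ (proj₁ (r x) d) , l)

  ~-lab← : ∀ {u q p} → u ~ q → lab Tgt q p → lab Src u p
  ~-lab← {q = _ , q₂} (related r) (inj₁ (x₁ , d₁ , l)) =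
    let (x₂ , d₂) = O₂.⟦⟧-nonempty q₂ in (x₁ , x₂) , proj₂ (r _) (d₁ , d₂) , inj₁ l
  ~-lab← {q = q₁ , _} (related r) (inj₂ (x₂ , d₂ , l)) =
    let (x₁ , d₁) = O₁.⟦⟧-nonempty q₁ in (x₁ , x₂) , proj₂ (r _) (d₁ , d₂) , inj₂ l

  init→ : ∀ {u} → I Src u → ∃ (u ~_)
  init→ {u} i = (O₁.initial (_ , proj₁ d) , O₂.initial (_ , proj₂ d)) , related C
    where
      C = ≐-trans i Rε-I
      d = proj₁ (C _) (proj₂ (OP.⟦⟧-nonempty u))

  init← : ∀ {q} → I Tgt q → ∃ (_~ q)
  init← {q₁ , q₂} (i₁ , i₂) = OP.initial (_ , proj₁ (C _) (proj₂ n₁ , proj₂ n₂)) , related (≐-sym C)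
    where
      C = ≐-trans (⊗-cong i₁ i₂) (≐-sym Rε-I)
      n₁ = O₁.⟦⟧-nonempty q₁
      n₂ = O₂.⟦⟧-nonempty q₂

  correspondence : Correspondence Src Tgt
  correspondence = record
    { _~_ = _~_
    ; alph→ = Alph-Src→Tgt
    ; alph← = Alph-Tgt→Src
    ; ~-≈→ = λ { {_} {_} {q} (related r) (related r′) e → ⟦⟧²-cancel q (≐-trans (≐-sym r) (≐-trans e r′)) }
    ; ~-≈← = λ { (related r) (related r′) (e₁ , e₂) → ≐-trans r (≐-trans (⊗-cong e₁ e₂) (≐-sym r′)) }
    ; ~-T→ = λ {_} {_} {_} {_} {l} → ~-T→ {l = l}
    ; ~-T← = λ {_} {_} {_} {_} {l} → ~-T← {l = l}
    ; ~-I→ = ~-I→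
    ; ~-I← = ~-I←
    ; ~-lab→ = ~-lab→
    ; ~-lab← = ~-lab←
    ; init→ = init→
    ; init← = init←
    ; step→ = λ {u} {_} {l} {v} ru t → Move-target ru (proj₂ (Src-step {u} {l} {v} t))
    ; step← = λ {_} {q} {l} {q′} ru t → Move-source ru (proj₂ (Tgt-step {q} {l} {q′} t))
    }

  Src≅Tgt : Acc Src ≅ Acc Tgt
  Src≅Tgt = Correspondence⇒Acc-≅ correspondence

proposition1 : ∀ {ℓ} (E AP : Set)
    -- an equivalence ∼ on transition systems
    (_∼_ : TS E AP → TS E AP → Set ℓ) → IsEquivalence _∼_ →
    -- reading: systems are identified up to isomorphism of accessible parts
    (∀ G H → Acc G ≅ Acc H → G ∼ H) →
    -- abstraction operator with G^{Σ'} ∼ G^{A^{Σ'}}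
    (𝒜 : (E → Set) → TS E AP → TS E AP) →
    (∀ Σ' G → hide Σ' G ∼ 𝒜 Σ' G) →
    -- congruence w.r.t. synchronous composition and hiding
    (∀ G H R → G ∼ H → (G ∥ R) ∼ (H ∥ R)) →
    (∀ Σ' G H → G ∼ H → hide Σ' G ∼ hide Σ' H) →
    (G₁ G₂ : TS E AP) → NoTau G₁ → NoTau G₂ →
    (Σh₁ Σh₂ Σh₁₂ : E → Set) →
    (∀ e → Σh₁ e → Alph G₁ e × ¬ Alph G₂ e) →
    (∀ e → Σh₂ e → Alph G₂ e × ¬ Alph G₁ e) →
    (∀ e → Σh₁₂ e → Alph G₁ e × Alph G₂ e) →
    hide (Σh₁ ∪ Σh₂ ∪ Σh₁₂) (Obs (G₁ ∥ G₂))
      ∼ 𝒜 Σh₁₂ (𝒜 Σh₁ (Obs G₁) ∥ 𝒜 Σh₂ (Obs G₂))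
-- The observer never follows τ transitions.
proposition1 E AP _∼_ ∼-equiv Acc-≅⇒∼ 𝒜 hide∼𝒜 ∥-congˡ hide-cong G₁ G₂ _ _ Σh₁ Σh₂ Σh₁₂
             Σh₁-local Σh₂-local Σh₁₂-shared = begin
  hide (Σh₁ ∪ Σh₂ ∪ Σh₁₂) (Obs (G₁ ∥ G₂))
    ≈⟨ Acc-≅⇒∼ _ _ (Decomposition.Src≅Tgt G₁ G₂ Σh₁ Σh₂ Σh₁₂ Σh₁-local Σh₂-local Σh₁₂-shared) ⟩
  hide Σh₁₂ (hide Σh₁ (Obs G₁) ∥ hide Σh₂ (Obs G₂))
    ≈⟨ hide-cong Σh₁₂ _ _ (∥-cong (hide∼𝒜 Σh₁ (Obs G₁)) (hide∼𝒜 Σh₂ (Obs G₂))) ⟩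
  hide Σh₁₂ (𝒜 Σh₁ (Obs G₁) ∥ 𝒜 Σh₂ (Obs G₂))
    ≈⟨ hide∼𝒜 Σh₁₂ _ ⟩
  𝒜 Σh₁₂ (𝒜 Σh₁ (Obs G₁) ∥ 𝒜 Σh₂ (Obs G₂)) ∎
  where
    ∼-setoid : Setoid (suc 0ℓ) _
    ∼-setoid = record { isEquivalence = ∼-equiv }

    open SetoidReasoning ∼-setoid

    ∥-comm∼ : ∀ G H → (G ∥ H) ∼ (H ∥ G)
    ∥-comm∼ G H = Acc-≅⇒∼ _ _ (Acc-≅ (∥-comm G H))

    ∥-cong : ∀ {G G′ H H′} → G ∼ G′ → H ∼ H′ → (G ∥ H) ∼ (G′ ∥ H′)
    ∥-cong {G} {G′} {H} {H′} p q = begin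
      G ∥ H   ≈⟨ ∥-congˡ G G′ H p ⟩
      G′ ∥ H  ≈⟨ ∥-comm∼ G′ H ⟩
      H ∥ G′  ≈⟨ ∥-congˡ H H′ G′ q ⟩
      H′ ∥ G′ ≈⟨ ∥-comm∼ H′ G′ ⟩
      G′ ∥ H′ ∎
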